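{- Let $G$ be a finite $2$-transitive permutation group with a regular normal subgroup $N$. Then $G$ is a Frobenius group if and only if $\mathrm{Der}_G=N\setminus\{1\}$.
   Context: $\mathrm{Der}_G$ denotes the set of derangements (fixed-point-free elements) of $G$. -}

module Defs where

open import Level using (Level; suc; _⊔_)
open import Data.Nat using (ℕ)
open import Data.Fin using (Fin)
open import Data.Product using (Σ; _×_; ∃; ∃-syntax)
open import Relation.Binary.PropositionalEquality using (_≡_; _≗_)
open import Relation.Nullary using (¬_)
open import Function using (id; _∘_)

-- Maps on the finite point set Ω = Fin n.  A permutation group on Ω is given by
-- its membership predicate on maps Fin n → Fin n (maps compared pointwise).
Map : ℕ → Set
Map n = Fin n → Fin n

Pred : ℕ → (ℓ : Level) → Set (suc ℓ)
Pred n ℓ = Map n → Set ℓ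

record IsPermGroup {n : ℕ} {ℓ : Level} (H : Pred n ℓ) : Set ℓ where
  field
    resp    : ∀ {g h} → g ≗ h → H g → H h
    has-id  : H id
    closed∘ : ∀ {g h} → H g → H h → H (g ∘ h)
    inverse : ∀ {g} → H g → Σ (Map n) λ h → H h × (h ∘ g ≗ id) × (g ∘ h ≗ id)

record IsNormalSubgroup {n : ℕ} {ℓ ℓ′ : Level} (N : Pred n ℓ′) (G : Pred n ℓ) : Set (ℓ ⊔ ℓ′) where
  field
    isGroup   : IsPermGroup N
    subset    : ∀ {g} → N g → G g
    conjugate : ∀ {g g⁻¹ x} → G g → G g⁻¹ → (g⁻¹ ∘ g ≗ id) → N x → N (g ∘ x ∘ g⁻¹)

Transitive : ∀ {n ℓ} → Pred n ℓ → Set ℓ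
Transitive {n} H = ∀ (a b : Fin n) → ∃[ g ] (H g × g a ≡ b)

TwoTransitive : ∀ {n ℓ} → Pred n ℓ → Set ℓ
TwoTransitive {n} H = ∀ (a b c d : Fin n) → ¬ a ≡ b → ¬ c ≡ d →
  ∃[ g ] (H g × g a ≡ c × g b ≡ d)

Regular : ∀ {n ℓ} → Pred n ℓ → Set ℓ
Regular {n} H = Transitive H × (∀ g (x : Fin n) → H g → g x ≡ x → g ≗ id)

Derangement : ∀ {n} → Map n → Set
Derangement {n} g = ∀ (x : Fin n) → ¬ g x ≡ x

Frobenius : ∀ {n ℓ} → Pred n ℓ → Set ℓ
Frobenius {n} H =
  Transitive H
  × (∃[ g ] (H g × ¬ (g ≗ id) × ∃[ x ] (g x ≡ x)))
  × (∀ g (x y : Fin n) → H g → ¬ x ≡ y → g x ≡ x → g y ≡ y → g ≗ id)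

DerEqualsNMinusOne : ∀ {n ℓ ℓ′} → Pred n ℓ → Pred n ℓ′ → Set (ℓ ⊔ ℓ′)
DerEqualsNMinusOne G N =
  ∀ g → G g → (Derangement g → N g × ¬ (g ≗ id)) × (N g × ¬ (g ≗ id) → Derangement g)

module Submission where

-- Regularity identifies N with Ω: an element m ∈ N is determined by m x
-- for a base point x, and for all a, b there is a unique translation carrying a
-- to b.  For any map h and point z, the unique m ∈ N with (m ∘ h) z ≡ z is the
-- translation from h z to z; record it by its value at x, giving a map
-- fixer x h : Ω → Ω whose fibre over m x is the fixed-point set of m ∘ h.
-- For h ≠ 1 fixing x:
--   * if no non-identity element of G fixes two points, fixer x h is injective,
--     hence (Ω finite) surjective, so every element of the coset N h has a
--     fixed point; thus a derangement of G cannot lie outside N;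
--   * if every element of N h has a fixed point, fixer x h is surjective, hence
--     injective; as fixer x h sends every fixed point of h to x, h fixes only x.
-- Elements of N ∖ {1} are derangements by regularity, transitivity comes from N,
-- and 2-transitivity on at least three points supplies a non-trivial point
-- stabiliser.  Normality of N is used only through N ⊆ G, so the development
-- below is stated for an arbitrary regular subgroup N of G.

open import Defs
open import Level using (Level)
open import Data.Nat using (ℕ; suc; _≤_; s≤s)
open import Data.Nat.Properties using (n<1+n)
open import Data.Fin using (Fin; zero; suc; punchOut; _<_)
open import Data.Fin.Properties using (_≟_; all?; any?; pigeonhole; punchOut-injective; <-irrefl)
open import Data.Product using (_×_; _,_; proj₁; proj₂; ∃₂; ∃-syntax)
open import Data.Sum using (_⊎_; inj₁; inj₂)
open import Data.Empty using (⊥-elim)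
open import Relation.Binary.PropositionalEquality
open import Relation.Nullary using (¬_; Dec; yes; no)
open import Function using (id; _∘_)
open import Function.Bundles using (_⇔_; mk⇔)
open import Function.Definitions using (Injective; StrictlySurjective)

-- Pigeonhole: an injective endomap of Fin n is surjective.  A missed value w
-- could be punched out of the codomain, giving an injection Fin (suc m) → Fin m.
injective⇒surjective : ∀ {n} (f : Map n) → Injective _≡_ _≡_ f → StrictlySurjective _≡_ f
injective⇒surjective {suc m} f f-inj w with any? (λ y → f y ≟ w)
... | yes hit = hit
... | no miss = ⊥-elim (no-collision (pigeonhole (n<1+n m) (λ i → punchOut (avoids i))))
  where
  avoids : ∀ i → ¬ w ≡ f i
  avoids i w≡fi = miss (i , sym w≡fi)
  no-collision : ¬ ∃₂ (λ i j → i < j × punchOut (avoids i) ≡ punchOut (avoids j))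
  no-collision (i , j , i<j , same) = <-irrefl (f-inj (punchOut-injective (avoids i) (avoids j) same)) i<j

-- A surjective endomap of Fin n is injective: a section s of f is injective,
-- hence surjective, and therefore also a left inverse of f.
surjective⇒injective : ∀ {n} (f : Map n) → StrictlySurjective _≡_ f → Injective _≡_ _≡_ f
surjective⇒injective f f-surj {a} {b} fa≡fb = begin
    a          ≡⟨ sym (s∘f≗id a) ⟩
    s (f a)    ≡⟨ cong s fa≡fb ⟩
    s (f b)    ≡⟨ s∘f≗id b ⟩
    b          ∎
  where
  open ≡-Reasoning
  s : Map _
  s w = proj₁ (f-surj w)
  f∘s≗id : ∀ w → f (s w) ≡ w
  f∘s≗id w = proj₂ (f-surj w)
  s-injective : Injective _≡_ _≡_ s
  s-injective {u} {v} su≡sv = trans (sym (f∘s≗id u)) (trans (cong f su≡sv) (f∘s≗id v))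
  s∘f≗id : ∀ a → s (f a) ≡ a
  s∘f≗id a with injective⇒surjective s s-injective a
  ... | a′ , sa′≡a = trans (cong (s ∘ f) (sym sa′≡a)) (trans (cong s (f∘s≗id a′)) sa′≡a)

fixed-point-or-derangement : ∀ {n} (g : Map n) → (∃[ z ] g z ≡ z) ⊎ Derangement g
fixed-point-or-derangement g with any? (λ z → g z ≟ z)
... | yes fixed = inj₁ fixed
... | no none = inj₂ (λ z gz≡z → none (z , gz≡z))

≗id? : ∀ {n} (g : Map n) → Dec (g ≗ id)
≗id? g = all? (λ w → g w ≟ w)

NoTwoFixedPoints : ∀ {n ℓ} → Pred n ℓ → Set ℓ
NoTwoFixedPoints {n} H = ∀ g (x y : Fin n) → H g → ¬ x ≡ y → g x ≡ x → g y ≡ y → g ≗ id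

-- A 2-transitive group on at least three points has a non-identity element
-- fixing a point: send 0 ↦ 0 and 1 ↦ 2.
nontrivial-stabiliser : ∀ {n ℓ} {G : Pred n ℓ} → 3 ≤ n → TwoTransitive G →
  ∃[ g ] (G g × ¬ (g ≗ id) × ∃[ x ] (g x ≡ x))
nontrivial-stabiliser (s≤s (s≤s (s≤s _))) two-trans
  with two-trans zero (suc zero) zero (suc (suc zero)) (λ ()) (λ ())
... | g , Gg , g0≡0 , g1≡2 = g , Gg , (λ g≗id → 1≢2 (trans (sym (g≗id (suc zero))) g1≡2)) , zero , g0≡0
  where
  1≢2 : ¬ suc zero ≡ suc (suc zero)
  1≢2 ()

module RegularSubgroup {ℓ ℓ′ : Level} {n : ℕ} (G : Pred n ℓ) (N : Pred n ℓ′)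
    (G-group : IsPermGroup G) (N-group : IsPermGroup N)
    (N⊆G : ∀ {g} → N g → G g) (N-regular : Regular N) where

  private
    module GG = IsPermGroup G-group
    module NG = IsPermGroup N-group

  free : ∀ {m} → N m → ∀ x → m x ≡ x → m ≗ id
  free {m} Nm x = proj₂ N-regular m x Nm

  G-transitive : Transitive G
  G-transitive a b with proj₁ N-regular a b
  ... | m , Nm , ma≡b = m , N⊆G Nm , ma≡b

  rigid : ∀ {a b} → N a → N b → ∀ u → a u ≡ b u → a ≗ b
  rigid {a} {b} Na Nb u au≡bu v with NG.inverse Nb
  ... | b⁻¹ , Nb⁻¹ , b⁻¹∘b≗id , b∘b⁻¹≗id = begin
      a v               ≡⟨ sym (b∘b⁻¹≗id (a v)) ⟩
      b (b⁻¹ (a v))     ≡⟨ cong b (free (NG.closed∘ Nb⁻¹ Na) u b⁻¹au≡u v) ⟩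
      b v               ∎
    where
    open ≡-Reasoning
    b⁻¹au≡u : b⁻¹ (a u) ≡ u
    b⁻¹au≡u = trans (cong b⁻¹ au≡bu) (b⁻¹∘b≗id u)

  translation : Fin n → Fin n → Map n
  translation a b = proj₁ (proj₁ N-regular a b)

  translation-∈N : ∀ a b → N (translation a b)
  translation-∈N a b = proj₁ (proj₂ (proj₁ N-regular a b))

  translation-sends : ∀ a b → translation a b a ≡ b
  translation-sends a b = proj₂ (proj₂ (proj₁ N-regular a b))

  translation-cancel : ∀ a b → translation b a ∘ translation a b ≗ id
  translation-cancel a b = free (NG.closed∘ (translation-∈N b a) (translation-∈N a b)) a
    (trans (cong (translation b a) (translation-sends a b)) (translation-sends b a))

  stabiliser-∩-N : ∀ {m h x} → N m → N (m ∘ h) → h x ≡ x → h ≗ id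
  stabiliser-∩-N {m} {h} {x} Nm Nmh hx≡x v with NG.inverse Nm
  ... | m⁻¹ , _ , m⁻¹∘m≗id , _ = begin
      h v              ≡⟨ sym (m⁻¹∘m≗id (h v)) ⟩
      m⁻¹ (m (h v))    ≡⟨ cong m⁻¹ (rigid Nmh Nm x (cong m hx≡x) v) ⟩
      m⁻¹ (m v)        ≡⟨ m⁻¹∘m≗id v ⟩
      v                ∎
    where open ≡-Reasoning

  -- fixer x h z is the value at x of the element of N which, composed with h,
  -- fixes z.  Identifying m ∈ N with m x, its fibres are fixed-point sets.
  fixer : Fin n → Map n → Map n
  fixer x h z = translation (h z) z x

  fixes⇒fixer : ∀ {m} x h z → N m → m (h z) ≡ z → fixer x h z ≡ m x
  fixes⇒fixer {m} x h z Nm mhz≡z =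
    rigid (translation-∈N (h z) z) Nm (h z) (trans (translation-sends (h z) z) (sym mhz≡z)) x

  fixer⇒fixes : ∀ {m} x h z → N m → fixer x h z ≡ m x → m (h z) ≡ z
  fixer⇒fixes {m} x h z Nm same-at-x =
    trans (rigid Nm (translation-∈N (h z) z) x (sym same-at-x) (h z)) (translation-sends (h z) z)

  -- If no non-identity element of G fixes two points, fixer x h is injective
  -- for every non-identity h ∈ G fixing x: two points in one fibre would be
  -- fixed by a single element m ∘ h of G, forcing m ∘ h = 1 and so h = 1.
  fixer-injective : NoTwoFixedPoints G → ∀ {h} x → G h → h x ≡ x → ¬ h ≗ id →
    Injective _≡_ _≡_ (fixer x h)
  fixer-injective no-two {h} x Gh hx≡x h≢id {y} {z} same with y ≟ z
  ... | yes y≡z = y≡z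
  ... | no y≢z = ⊥-elim (h≢id (stabiliser-∩-N Nm (NG.resp (λ v → sym (m∘h≗id v)) NG.has-id) hx≡x))
    where
    m : Map n
    m = translation (h z) z
    Nm : N m
    Nm = translation-∈N (h z) z
    m∘h≗id : m ∘ h ≗ id
    m∘h≗id = no-two (m ∘ h) y z (GG.closed∘ (N⊆G Nm) Gh) y≢z
      (fixer⇒fixes x h y Nm same) (translation-sends (h z) z)

  -- If every element of the coset N h has a fixed point, fixer x h is surjective:
  -- a fixed point of translation x w ∘ h lies over w.
  fixer-surjective : ∀ x h → (∀ {m} → N m → ∃[ z ] m (h z) ≡ z) → StrictlySurjective _≡_ (fixer x h)
  fixer-surjective x h coset-fixes w with coset-fixes (translation-∈N x w)
  ... | z , fixed = z , trans (fixes⇒fixer x h z (translation-∈N x w) fixed) (translation-sends x w)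

  N∖1⊆Der : ∀ {g} → N g → ¬ (g ≗ id) → Derangement g
  N∖1⊆Der Ng g≢id w gw≡w = g≢id (free Ng w gw≡w)

  -- Write g = m ∘ h with m ∈ N and h fixing x; if h ≠ 1
  -- then fixer x h is a bijection, so m ∘ h has a fixed point.
  Der⊆N : Fin n → NoTwoFixedPoints G → ∀ {g} → G g → Derangement g → N g
  Der⊆N x no-two {g} Gg g-der = from-coset (≗id? h)
    where
    m h : Map n
    m = translation x (g x)
    h = translation (g x) x ∘ g
    Gh : G h
    Gh = GG.closed∘ (N⊆G (translation-∈N (g x) x)) Gg
    hx≡x : h x ≡ x
    hx≡x = translation-sends (g x) x
    g≗m∘h : g ≗ m ∘ h
    g≗m∘h v = sym (translation-cancel (g x) x (g v))
    from-coset : Dec (h ≗ id) → N g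
    from-coset (yes h≗id) = NG.resp (λ v → trans (cong m (sym (h≗id v))) (sym (g≗m∘h v))) (translation-∈N x (g x))
    from-coset (no h≢id)
      with injective⇒surjective (fixer x h) (fixer-injective no-two x Gh hx≡x h≢id) (m x)
    ... | z , over-mx = ⊥-elim (g-der z (trans (g≗m∘h z) (fixer⇒fixes x h z (translation-∈N x (g x)) over-mx)))

  -- If every derangement of G lies in N, no non-identity element fixes two
  -- points: for h ≠ 1 fixing x, no element of N h is a derangement, so fixer x h
  -- is a bijection; but it sends every fixed point of h to x.
  Der⊆N⇒NoTwoFixedPoints : (∀ {g} → G g → Derangement g → N g) → NoTwoFixedPoints G
  Der⊆N⇒NoTwoFixedPoints Der⊆N h x y Gh x≢y hx≡x hy≡y with ≗id? h
  ... | yes h≗id = h≗id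
  ... | no h≢id = ⊥-elim (x≢y (fixer-inj (trans fixer-at-x (sym fixer-at-y))))
    where
    coset-fixes : ∀ {m} → N m → ∃[ z ] m (h z) ≡ z
    coset-fixes {m} Nm with fixed-point-or-derangement (m ∘ h)
    ... | inj₁ fixed = fixed
    ... | inj₂ der = ⊥-elim (h≢id (stabiliser-∩-N Nm (Der⊆N (GG.closed∘ (N⊆G Nm) Gh) der) hx≡x))
    fixer-inj : Injective _≡_ _≡_ (fixer x h)
    fixer-inj = surjective⇒injective (fixer x h) (fixer-surjective x h coset-fixes)
    fixer-at-x : fixer x h x ≡ x
    fixer-at-x = fixes⇒fixer x h x NG.has-id hx≡x
    fixer-at-y : fixer x h y ≡ x
    fixer-at-y = fixes⇒fixer x h y NG.has-id hy≡y

  frobenius⇒Der≡N∖1 : Fin n → Frobenius G → DerEqualsNMinusOne G N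
  frobenius⇒Der≡N∖1 x (_ , _ , no-two) g Gg =
    (λ g-der → Der⊆N x no-two Gg g-der , λ g≗id → g-der x (g≗id x)) ,
    (λ (Ng , g≢id) → N∖1⊆Der Ng g≢id)

  Der≡N∖1⇒frobenius : ∃[ g ] (G g × ¬ (g ≗ id) × ∃[ x ] (g x ≡ x)) →
    DerEqualsNMinusOne G N → Frobenius G
  Der≡N∖1⇒frobenius nontrivial Der≡N∖1 =
    G-transitive , nontrivial , Der⊆N⇒NoTwoFixedPoints (λ {g} Gg g-der → proj₁ (proj₁ (Der≡N∖1 g Gg) g-der))

some-point : ∀ {n} → 3 ≤ n → Fin n
some-point (s≤s _) = zero

proposition5p6 : ∀ {ℓ ℓ′ : Level} (n : ℕ) → 3 ≤ n → (G : Pred n ℓ) (N : Pred n ℓ′) →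
    IsPermGroup G → TwoTransitive G → IsNormalSubgroup N G → Regular N →
    (Frobenius G ⇔ DerEqualsNMinusOne G N)
proposition5p6 n 3≤n G N G-group two-trans N-normal N-regular =
  mk⇔ (frobenius⇒Der≡N∖1 (some-point 3≤n))
      (Der≡N∖1⇒frobenius (nontrivial-stabiliser 3≤n two-trans))
  where
  open IsNormalSubgroup N-normal using (isGroup; subset)
  open RegularSubgroup G N G-group isGroup subset N-regular
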